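{- Let $n\geq k\geq 1$, let $S\neq T$ be $k$-subsets of $[n]$, and let $C$ be a path component of $h(S,T)$. Then among the edges $\{x,y\}$ of $C$ (with $x\in[n]\setminus[k]$, $y\in[k]$), the only one for which $(x,y)$ is $(S,T)$-good is $\{x_{max}(C),y_{min}(C)\}$.
   Context: $[m]=\{1,\dots,m\}$. For a $k$-subset $S$ of $[n]$ define $f(S)\subseteq([n]\setminus[k])\times[k]$: if $S=[k]$ then $f(S)=\emptyset$; otherwise let $S\setminus[k]=\{x_1,\dots,x_t\}$ with $n\geq x_1>\dots>x_t\geq k+1$ and $[k]\setminus S=\{y_1,\dots,y_t\}$ with $1\leq y_1<\dots<y_t\leq k$, and set $f(S)=\{(x_1,y_1),\dots,(x_t,y_t)\}$. Let $h(S)$ be the graph on $[n]$ whose edges are the pairs $\{x,y\}$ with $(x,y)\in f(S)$, and $h(S,T)$ the multigraph union of $h(S)$ and $h(T)$. A path component is a connected component that is a path with at least one edge. For such $C$ (viewed as its vertex set): $x_{max}(C)=\max(C\cap([n]\setminus[k]))$, $y_{min}(C)=\min(C\cap[k])$. For each $k$-subset $S$ and each $(x,y)\in([n]\setminus[k])\times[k]$ define $a(S,(x,y))\in\{0,1,*\}$ by the first applicable rule: (1) if $(x,y)\in f(S)$, then $1$; (2) else if $\max(S)<x$, then $0$; (3) else if there is $z<y$ with $(x,z)\in f(S)$, then $*$; (4) else if $y\in S$, then $0$; (5) else if there is $z<x$ with $(z,y)\in f(S)$, then $0$; (6) else $*$. A pair $(x,y)$ is $(S,T)$-good if $\{a(S,(x,y)),a(T,(x,y))\}=\{0,1\}$.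 -}

module Defs where

open import Data.Nat.Base using (ℕ; zero; suc; _+_; _⊔_; _⊓_; _≡ᵇ_; _<ᵇ_; _≤_)
open import Data.Bool.Base using (Bool; true; false; not; _∧_; _∨_; if_then_else_)
open import Data.Fin.Base using (Fin; toℕ)
open import Data.Fin.Subset using (Subset)
open import Data.Vec.Base using (lookup)
open import Data.List.Base using (List; []; _∷_; map; filterᵇ; zip; upTo; downFrom; allFin; foldr; length; _++_)
open import Data.Bool.ListAction using (any)
open import Data.List.Membership.Propositional using (_∈_)
open import Data.List.Relation.Unary.Unique.Propositional using (Unique)
open import Data.List.Relation.Binary.Permutation.Propositional using (_↭_)
open import Data.Product.Base using (_×_; _,_)
open import Data.Sum.Base using (_⊎_)
open import Relation.Binary.PropositionalEquality using (_≡_)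

-- Convention: a subset S ⊆ [n] = {1,…,n} is a library `Subset n`
-- (Vec Bool n); the index i : Fin n stands for the number toℕ i + 1.

elems : ∀ {n} → Subset n → List ℕ
elems {n} S = map (λ i → suc (toℕ i)) (filterᵇ (λ i → lookup S i) (allFin n))

memB : ∀ {n} → Subset n → ℕ → Bool
memB S x = any (λ e → x ≡ᵇ e) (elems S)

-- max(S) (S is nonempty in our use)
maxS : ∀ {n} → Subset n → ℕ
maxS S = foldr _⊔_ 0 (elems S)

bigOut : ∀ {n} → ℕ → Subset n → List ℕ
bigOut {n} k S = filterᵇ (λ x → (k <ᵇ x) ∧ memB S x) (map suc (downFrom n))

smallMissing : ∀ {n} → ℕ → Subset n → List ℕ
smallMissing k S = filterᵇ (λ y → not (memB S y)) (map suc (upTo k))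

f : ∀ {n} → ℕ → Subset n → List (ℕ × ℕ)
f k S = zip (bigOut k S) (smallMissing k S)

pairEqB : ℕ × ℕ → ℕ × ℕ → Bool
pairEqB (a , b) (c , d) = (a ≡ᵇ c) ∧ (b ≡ᵇ d)

inFB : ∀ {n} → ℕ → Subset n → ℕ → ℕ → Bool
inFB k S x y = any (pairEqB (x , y)) (f k S)

data Val : Set where
  v0 v1 v* : Val

-- a(S,(x,y)) by the first applicable rule (1)–(6)
a : ∀ {n} → ℕ → Subset n → ℕ → ℕ → Val
a k S x y =
  if inFB k S x y then v1
  else if maxS S <ᵇ x then v0
  else if any (λ p → (Data.Product.Base.proj₁ p ≡ᵇ x) ∧ (Data.Product.Base.proj₂ p <ᵇ y)) (f k S) then v*
  else if memB S y then v0
  else if any (λ p → (Data.Product.Base.proj₂ p ≡ᵇ y) ∧ (Data.Product.Base.proj₁ p <ᵇ x)) (f k S) then v0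
  else v*

Good : ∀ {n} → ℕ → Subset n → Subset n → ℕ → ℕ → Set
Good k S T x y = (a k S x y ≡ v0 × a k T x y ≡ v1) ⊎ (a k S x y ≡ v1 × a k T x y ≡ v0)

-- Edge multiset of the multigraph h(S,T): each edge {x,y} recorded as (x,y)
-- with x ∈ [n]∖[k], y ∈ [k]; edges of h(S) and h(T) are both kept (multigraph union).
hEdges : ∀ {n} → ℕ → Subset n → Subset n → List (ℕ × ℕ)
hEdges k S T = f k S ++ f k T

incident : List (ℕ × ℕ) → List ℕ → List (ℕ × ℕ)
incident E C = filterᵇ (λ e → any (λ v → (Data.Product.Base.proj₁ e ≡ᵇ v) ∨ (Data.Product.Base.proj₂ e ≡ᵇ v)) C) E

pathEdges : List ℕ → List (ℕ × ℕ)
pathEdges (v ∷ w ∷ rest) = (v ⊔ w , v ⊓ w) ∷ pathEdges (w ∷ rest)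
pathEdges _ = []

-- The vertex list C = v₀,…,v_m is a path component of the multigraph with edge
-- list E: distinct vertices, at least one edge (m ≥ 1), and the multiset of
-- edges meeting {v₀,…,v_m} is exactly the multiset of path edges v_i v_{i+1}.
-- (Then {v₀,…,v_m} is closed under adjacency and connected, i.e. a connected
-- component, and that component is a path with ≥ 1 edge; conversely.)
record PathComponent (E : List (ℕ × ℕ)) (C : List ℕ) : Set where
  field
    distinct  : Unique C
    nontriv   : 2 ≤ length C
    edgesPath : incident E C ↭ pathEdges C

-- x_max(C) = max(C ∩ ([n]∖[k])), y_min(C) = min(C ∩ [k])
-- (both intersections are nonempty for a path component, so the
-- seeds 0 and k of the folds are never the result unless attained)
xmax : ℕ → List ℕ → ℕ
xmax k C = foldr _⊔_ 0 (filterᵇ (λ v → k <ᵇ v) C)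

ymin : ℕ → List ℕ → ℕ
ymin k C = foldr _⊓_ k (filterᵇ (λ v → not (k <ᵇ v)) C)

module Submission where

-- f(X) matches the elements of X above k with the non-elements of X in [k], antitonically (larger
-- sources get smaller targets), and when |X| = k every non-element in [k] is matched.  A path
-- component C of h(S,T) alternates between edges of f(S) and of f(T), so edges two apart on C lie
-- in one matching, and antitonicity propagates along C: read from the proper end, its vertices
-- above k decrease and its vertices in [k] increase.  So the first edge of C is {x_max(C), y_min(C)}.
-- If it belongs to f(Q), Q ∈ {S, T}, then rules (2)–(5) and the shape of C near its end give
-- a(P, ·) = 0 on it for the other set P; every later edge of f(Q) on C is preceded by an edge of
-- f(P), which triggers rule (3) or makes (4)–(5) fail, so a(P, ·) = * there.

open import Data.Bool.Base using (Bool; true; false; not; _∧_; _∨_; T; if_then_else_)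
open import Data.Bool.ListAction using (any; or)
open import Data.Bool.Properties using (T-∧; T-∨; ∧-zeroʳ; ∧-identityʳ; ∨-identityʳ)
open import Data.Empty using (⊥)
open import Data.Fin.Base as Fin using (toℕ)
open import Data.Fin.Subset using (Subset; ∣_∣)
open import Data.List.Base
  using (List; []; _∷_; _++_; _∷ʳ_; _∷ʳ′_; initLast; length; reverse; map; filterᵇ; zip; foldr;
         upTo; downFrom; applyUpTo; allFin; tabulate)
open import Data.List.Membership.Propositional using (_∈_; _∉_; find; lose)
open import Data.List.Membership.Propositional.Properties
  using (∈-++⁺ˡ; ∈-++⁺ʳ; ∈-++⁻; ∈-map⁺; ∈-map⁻; ∈-filter⁺; ∈-filter⁻; ∈-upTo⁺; ∈-upTo⁻)
open import Data.List.Properties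
  using (∷-injective; ∷-injectiveʳ; ∷ʳ-injectiveʳ; ++-assoc; ++-cancelˡ; filter-++; map-∘; map-tabulate;
         map-upTo; length-reverse; reverse-++; reverse-involutive; reverse-upTo; foldr-preservesᵇ; foldr-preservesᵒ)
open import Data.List.Relation.Binary.Permutation.Propositional using (_↭_; ↭-sym; ↭⇒↭ₛ)
open import Data.List.Relation.Binary.Permutation.Propositional.Properties as ↭
  using (↭-reverse; ↭-length; filter-↭; ∈-resp-↭)
import Data.List.Relation.Binary.Permutation.Setoid.Properties as ↭ₛ
open import Data.List.Relation.Unary.All as All using (All)
open import Data.List.Relation.Unary.AllPairs as AllPairs using (AllPairs; []; _∷_)
import Data.List.Relation.Unary.AllPairs.Properties as AllPairsₚ
open import Data.List.Relation.Unary.Any as Any using (here; there)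
open import Data.List.Relation.Unary.Any.Properties using (any⁺; any⁻; reverse⁺; reverse⁻)
open import Data.List.Relation.Unary.Linked as Linked using (Linked; []; [-]; _∷_)
open import Data.List.Relation.Unary.Unique.Propositional using (Unique)
open import Data.Nat.Base
open import Data.Nat.Properties
open import Data.Product.Base using (_×_; _,_; proj₁; proj₂; ∃; ∃₂)
open import Data.Product.Properties using (,-injective)
open import Data.Sum.Base as Sum using (_⊎_; inj₁; inj₂; [_,_])
open import Data.Unit.Base using (⊤)
open import Data.Vec.Base using ([]; _∷_; lookup)
open import Function.Base using (_∘_; id; flip)
open import Function.Bundles using (Equivalence)
open import Relation.Binary.Definitions using (tri<; tri≈; tri>)
open import Relation.Binary.PropositionalEquality as ≡
  using (_≡_; _≢_; _≗_; refl; sym; trans; cong; cong₂; subst; subst₂; module ≡-Reasoning)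
open import Relation.Nullary using (¬_; contradiction; yes; no)
open import Relation.Nullary.Decidable using (T?)

open import Defs

private
  variable
    A B : Set
    b : Bool
    n k x y x′ y′ z : ℕ
    xs ys : List ℕ
    X : Subset n
    R : ℕ → ℕ → Set

T-not⇒¬T : T (not b) → ¬ T b
T-not⇒¬T {false} _ ()

¬T⇒T-not : ¬ T b → T (not b)
¬T⇒T-not {false} _ = _
¬T⇒T-not {true} ¬t = ¬t _

any-map : ∀ (p : B → Bool) (g : A → B) ws → any p (map g ws) ≡ any (p ∘ g) ws
any-map p g ws = cong or (sym (map-∘ ws))

any-filterᵇ : ∀ (p q : A → Bool) ws → any p (filterᵇ q ws) ≡ any (λ x → q x ∧ p x) ws
any-filterᵇ p q []       = refl
any-filterᵇ p q (x ∷ ws) with q x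
... | true  = cong (p x ∨_) (any-filterᵇ p q ws)
... | false = any-filterᵇ p q ws

any-false : ∀ (p : A → Bool) → (∀ x → p x ≡ false) → ∀ ws → any p ws ≡ false
any-false p p≡false []       = refl
any-false p p≡false (x ∷ ws) rewrite p≡false x = any-false p p≡false ws

∈⇒≤foldr-⊔ : x ∈ xs → x ≤ foldr _⊔_ 0 xs
∈⇒≤foldr-⊔ {xs = xs} x∈xs = foldr-preservesᵒ (λ u v → [ m≤n⇒m≤n⊔o v , m≤n⇒m≤o⊔n u ]) 0 xs
  (inj₂ (Any.map ≤-reflexive x∈xs))

foldr-⊔-≤ : All (_≤ z) xs → foldr _⊔_ 0 xs ≤ z
foldr-⊔-≤ = foldr-preservesᵇ ⊔-lub z≤n

∈⇒foldr-⊓≤ : ∀ s → x ∈ xs → foldr _⊓_ s xs ≤ x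
∈⇒foldr-⊓≤ {xs = xs} s x∈xs = foldr-preservesᵒ (λ u v → [ m≤n⇒m⊓o≤n v , m≤n⇒o⊓m≤n u ]) s xs
  (inj₂ (Any.map (≤-reflexive ∘ sym) x∈xs))

≤-foldr-⊓ : ∀ {s} → z ≤ s → All (z ≤_) xs → z ≤ foldr _⊓_ s xs
≤-foldr-⊓ = foldr-preservesᵇ ⊓-glb

xmax≡ : ∀ {C} → z ∈ C → k < z → (∀ {v} → v ∈ C → k < v → v ≤ z) → xmax k C ≡ z
xmax≡ {z} {k} {C} z∈C k<z bound = ≤-antisym
  (foldr-⊔-≤ (All.tabulate λ v∈ → let v∈C , k<v = ∈-filter⁻ (T? ∘ (k <ᵇ_)) {xs = C} v∈
                                   in bound v∈C (<ᵇ⇒< k _ k<v)))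
  (∈⇒≤foldr-⊔ (∈-filter⁺ (T? ∘ (k <ᵇ_)) z∈C (<⇒<ᵇ k<z)))

ymin≡ : ∀ {C} → z ∈ C → z ≤ k → (∀ {v} → v ∈ C → v ≤ k → z ≤ v) → ymin k C ≡ z
ymin≡ {z} {k} {C} z∈C z≤k bound = ≤-antisym
  (∈⇒foldr-⊓≤ k (∈-filter⁺ (T? ∘ not ∘ (k <ᵇ_)) z∈C (¬T⇒T-not (λ t → <⇒≱ (<ᵇ⇒< k z t) z≤k))))
  (≤-foldr-⊓ z≤k (All.tabulate λ v∈ → let v∈C , v≤k = ∈-filter⁻ (T? ∘ not ∘ (k <ᵇ_)) {xs = C} v∈
                                       in bound v∈C (≮⇒≥ (T-not⇒¬T v≤k ∘ <⇒<ᵇ))))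

-- Counting

count : (ℕ → Bool) → ℕ → ℕ
count p zero    = zero
count p (suc m) = (if p 0 then suc else id) (count (p ∘ suc) m)

count-cong : ∀ {p q : ℕ → Bool} → p ≗ q → ∀ m → count p m ≡ count q m
count-cong p≗q zero    = refl
count-cong p≗q (suc m) =
  cong₂ (λ c → if c then suc else id) (p≗q 0) (count-cong (p≗q ∘ suc) m)

length-filterᵇ-applyUpTo : ∀ (p : ℕ → Bool) g m → length (filterᵇ p (applyUpTo g m)) ≡ count (p ∘ g) m
length-filterᵇ-applyUpTo p g zero = refl
length-filterᵇ-applyUpTo p g (suc m) with p (g 0)
... | true  = cong suc (length-filterᵇ-applyUpTo p (g ∘ suc) m)
... | false = length-filterᵇ-applyUpTo p (g ∘ suc) m

count-split : ∀ (q : ℕ → Bool) {k n} → k ≤ n → count (λ i → (k <ᵇ suc i) ∧ q i) n + count q k ≡ count q n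
count-split q {zero} {n} _ = +-identityʳ (count q n)
count-split q {suc k} {suc n} (s≤s k≤n) with q 0 | count-split (q ∘ suc) k≤n
... | true  | ih = trans (+-suc _ _) (cong suc ih)
... | false | ih = ih

count-complement : ∀ (q : ℕ → Bool) m → count q m + count (not ∘ q) m ≡ m
count-complement q zero = refl
count-complement q (suc m) with q 0 | count-complement (q ∘ suc) m
... | true  | ih = cong suc ih
... | false | ih = trans (+-suc _ _) (cong suc ih)

memB≡any-lookup : ∀ {n} (X : Subset n) y →
                  memB X y ≡ any (λ i → lookup X i ∧ (y ≡ᵇ suc (toℕ i))) (allFin n)
memB≡any-lookup {n} X y =
  trans (any-map (y ≡ᵇ_) (suc ∘ toℕ) (filterᵇ (lookup X) (allFin n))) (any-filterᵇ _ (lookup X) (allFin n))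

memB-∷ : ∀ {n} b (X : Subset n) y → memB (b ∷ X) (suc y) ≡ (b ∧ (y ≡ᵇ 0)) ∨ memB X y
memB-∷ {n} b X y = begin
  memB (b ∷ X) (suc y)
    ≡⟨ memB≡any-lookup (b ∷ X) (suc y) ⟩
  (b ∧ (y ≡ᵇ 0)) ∨ any p (tabulate Fin.suc)
    ≡⟨ cong (λ is → (b ∧ (y ≡ᵇ 0)) ∨ any p is) (sym (map-tabulate id Fin.suc)) ⟩
  (b ∧ (y ≡ᵇ 0)) ∨ any p (map Fin.suc (allFin n))
    ≡⟨ cong ((b ∧ (y ≡ᵇ 0)) ∨_) (trans (any-map p Fin.suc (allFin n)) (sym (memB≡any-lookup X y))) ⟩
  (b ∧ (y ≡ᵇ 0)) ∨ memB X y
    ∎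
  where
  open ≡-Reasoning
  p = λ i → lookup (b ∷ X) i ∧ (suc y ≡ᵇ suc (toℕ i))

memB-zero : ∀ {n} (X : Subset n) → memB X 0 ≡ false
memB-zero {n} X = trans (memB≡any-lookup X 0) (any-false _ (λ i → ∧-zeroʳ (lookup X i)) (allFin n))

memB-∷-one : ∀ {n} b (X : Subset n) → memB (b ∷ X) 1 ≡ b
memB-∷-one b X rewrite memB-∷ b X 0 | memB-zero X | ∧-identityʳ b = ∨-identityʳ b

memB-∷-suc : ∀ {n} b (X : Subset n) y → memB (b ∷ X) (suc (suc y)) ≡ memB X (suc y)
memB-∷-suc b X y rewrite memB-∷ b X (suc y) | ∧-zeroʳ b = refl

∣∣≡count-memB : ∀ {n} (X : Subset n) → ∣ X ∣ ≡ count (memB X ∘ suc) n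
∣∣≡count-memB [] = refl
∣∣≡count-memB {suc n} (b ∷ X) = begin
  ∣ b ∷ X ∣
    ≡⟨ ∣∷∣ b ⟩
  (if b then suc else id) ∣ X ∣
    ≡⟨ cong₂ (λ c → if c then suc else id) (sym (memB-∷-one b X))
             (trans (∣∣≡count-memB X) (count-cong (sym ∘ memB-∷-suc b X) n)) ⟩
  count (memB (b ∷ X) ∘ suc) (suc n)
    ∎
  where
  open ≡-Reasoning
  ∣∷∣ : ∀ b → ∣ b ∷ X ∣ ≡ (if b then suc else id) ∣ X ∣
  ∣∷∣ true  = refl
  ∣∷∣ false = refl

[n…1]↭[1…n] : ∀ n → map suc (downFrom n) ↭ applyUpTo suc n
[n…1]↭[1…n] n = subst₂ _↭_ (cong (map suc) (reverse-upTo n)) (map-upTo suc n) (↭.map⁺ suc (↭-reverse (upTo n)))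

length-bigOut : ∀ {n} k (X : Subset n) → length (bigOut k X) ≡ count (λ i → (k <ᵇ suc i) ∧ memB X (suc i)) n
length-bigOut {n} k X = trans (↭-length (filter-↭ (T? ∘ p) ([n…1]↭[1…n] n))) (length-filterᵇ-applyUpTo p suc n)
  where p = λ x → (k <ᵇ x) ∧ memB X x

length-smallMissing : ∀ {n} k (X : Subset n) → length (smallMissing k X) ≡ count (not ∘ memB X ∘ suc) k
length-smallMissing k X =
  trans (cong (length ∘ filterᵇ (not ∘ memB X)) (map-upTo suc k)) (length-filterᵇ-applyUpTo (not ∘ memB X) suc k)

length-bigOut≡length-smallMissing : ∀ {n} {X : Subset n} → k ≤ n → ∣ X ∣ ≡ k →
  length (bigOut k X) ≡ length (smallMissing k X)
length-bigOut≡length-smallMissing {k} {n} {X} k≤n ∣X∣≡k = +-cancelʳ-≡ c _ _ (begin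
  length (bigOut k X) + c                     ≡⟨ cong (_+ c) (length-bigOut k X) ⟩
  count (λ i → (k <ᵇ suc i) ∧ memB X (suc i)) n + c ≡⟨ count-split (memB X ∘ suc) k≤n ⟩
  count (memB X ∘ suc) n                       ≡⟨ sym (∣∣≡count-memB X) ⟩
  ∣ X ∣                                        ≡⟨ ∣X∣≡k ⟩
  k                                            ≡⟨ sym (count-complement (memB X ∘ suc) k) ⟩
  c + count (not ∘ memB X ∘ suc) k             ≡⟨ +-comm c _ ⟩
  count (not ∘ memB X ∘ suc) k + c             ≡⟨ cong (_+ c) (sym (length-smallMissing k X)) ⟩
  length (smallMissing k X) + c                ∎)
  where
  open ≡-Reasoning
  c = count (memB X ∘ suc) k

-- The matching f k X

∈-zip⁻ : (x , y) ∈ zip xs ys → x ∈ xs × y ∈ ys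
∈-zip⁻ {xs = _ ∷ _} {_ ∷ _} (here refl) = here refl , here refl
∈-zip⁻ {xs = _ ∷ _} {_ ∷ _} (there p)   with x∈ , y∈ ← ∈-zip⁻ p = there x∈ , there y∈

zip-comparable : AllPairs _>_ xs → AllPairs _<_ ys → (x , y) ∈ zip xs ys → (x′ , y′) ∈ zip xs ys →
  (x ≡ x′ × y ≡ y′) ⊎ (x′ < x × y < y′) ⊎ (x < x′ × y′ < y)
zip-comparable {xs = _ ∷ _} {ys = _ ∷ _} _ _ (here refl) (here refl) = inj₁ (refl , refl)
zip-comparable {xs = _ ∷ _} {ys = _ ∷ _} (x> ∷ _) (y< ∷ _) (here refl) (there q) with x′∈ , y′∈ ← ∈-zip⁻ q =
  inj₂ (inj₁ (All.lookup x> x′∈ , All.lookup y< y′∈))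
zip-comparable {xs = _ ∷ _} {ys = _ ∷ _} (x′> ∷ _) (y′< ∷ _) (there p) (here refl) with x∈ , y∈ ← ∈-zip⁻ p =
  inj₂ (inj₂ (All.lookup x′> x∈ , All.lookup y′< y∈))
zip-comparable {xs = _ ∷ _} {ys = _ ∷ _} (_ ∷ xs↓) (_ ∷ ys↑) (there p) (there q) = zip-comparable xs↓ ys↑ p q

zip-complete : length ys ≤ length xs → y ∈ ys → ∃ λ x → (x , y) ∈ zip xs ys
zip-complete {ys = _ ∷ _} {xs = x ∷ _} _ (here refl) = x , here refl
zip-complete {ys = _ ∷ _} {xs = _ ∷ _} (s≤s ∣ys∣≤∣xs∣) (there y∈) with x , p ← zip-complete ∣ys∣≤∣xs∣ y∈ =
  x , there p

bigOut-decreasing : ∀ k (X : Subset n) → AllPairs _>_ (bigOut k X)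
bigOut-decreasing {n} k X =
  AllPairsₚ.filter⁺ _ (AllPairsₚ.map⁺ (AllPairsₚ.applyDownFrom⁺₁ id n (λ j<i _ → s<s j<i)))

smallMissing-increasing : ∀ k (X : Subset n) → AllPairs _<_ (smallMissing k X)
smallMissing-increasing k X =
  AllPairsₚ.filter⁺ _ (AllPairsₚ.map⁺ (AllPairsₚ.applyUpTo⁺₁ id k (λ i<j _ → s<s i<j)))

memB⇒≤maxS : ∀ {X : Subset n} → T (memB X x) → x ≤ maxS X
memB⇒≤maxS {x = x} {X = X} t = ∈⇒≤foldr-⊔ (Any.map (≡ᵇ⇒≡ x _) (any⁻ (x ≡ᵇ_) (elems X) t))

module Matching {n} (k : ℕ) (X : Subset n) where

  comparable : (x , y) ∈ f k X → (x′ , y′) ∈ f k X →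
               (x ≡ x′ × y ≡ y′) ⊎ (x′ < x × y < y′) ⊎ (x < x′ × y′ < y)
  comparable = zip-comparable (bigOut-decreasing k X) (smallMissing-increasing k X)

  functional : (x , y) ∈ f k X → (x , y′) ∈ f k X → y ≡ y′
  functional p q with comparable p q
  ... | inj₁ (_ , y≡y′)         = y≡y′
  ... | inj₂ (inj₁ (x<x , _)) = contradiction x<x (<-irrefl refl)
  ... | inj₂ (inj₂ (x<x , _)) = contradiction x<x (<-irrefl refl)

  injective : (x , y) ∈ f k X → (x′ , y) ∈ f k X → x ≡ x′
  injective p q with comparable p q
  ... | inj₁ (x≡x′ , _)         = x≡x′
  ... | inj₂ (inj₁ (_ , y<y)) = contradiction y<y (<-irrefl refl)
  ... | inj₂ (inj₂ (_ , y<y)) = contradiction y<y (<-irrefl refl)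

  antitone : (x , y) ∈ f k X → (x′ , y′) ∈ f k X → x < x′ → y′ < y
  antitone p q x<x′ with comparable p q
  ... | inj₁ (refl , _)         = contradiction x<x′ (<-irrefl refl)
  ... | inj₂ (inj₁ (x′<x , _)) = contradiction x′<x (<-asym x<x′)
  ... | inj₂ (inj₂ (_ , y′<y)) = y′<y

  antitone⁻ : (x , y) ∈ f k X → (x′ , y′) ∈ f k X → y < y′ → x′ < x
  antitone⁻ p q y<y′ with comparable p q
  ... | inj₁ (_ , refl)         = contradiction y<y′ (<-irrefl refl)
  ... | inj₂ (inj₁ (x′<x , _)) = x′<x
  ... | inj₂ (inj₂ (_ , y′<y)) = contradiction y′<y (<-asym y<y′)

  ∈-f⁻ : (x , y) ∈ f k X → x ∈ bigOut k X × y ∈ smallMissing k X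
  ∈-f⁻ = ∈-zip⁻

  source : (x , y) ∈ f k X → k < x × T (memB X x)
  source p with _ , t ← ∈-filter⁻ (T? ∘ λ x → (k <ᵇ x) ∧ memB X x) {xs = map suc (downFrom n)} (proj₁ (∈-f⁻ p))
    with k<x , x∈X ← Equivalence.to T-∧ t = <ᵇ⇒< k _ k<x , x∈X

  target : (x , y) ∈ f k X → 0 < y × y ≤ k × ¬ T (memB X y)
  target p with y∈[1…k] , y∉X ← ∈-filter⁻ (T? ∘ not ∘ memB X) {xs = map suc (upTo k)} (proj₂ (∈-f⁻ p))
    with i , i∈ , refl ← ∈-map⁻ suc y∈[1…k] = z<s , ∈-upTo⁻ i∈ , T-not⇒¬T y∉X

  sides : (x , y) ∈ f k X → k < x × y ≤ k
  sides p = proj₁ (source p) , proj₁ (proj₂ (target p))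

  complete : k ≤ n → ∣ X ∣ ≡ k → 0 < y → y ≤ k → ¬ T (memB X y) → ∃ λ x → (x , y) ∈ f k X
  complete {y = suc i} k≤n ∣X∣≡k _ y≤k y∉X =
    zip-complete (≤-reflexive (sym (length-bigOut≡length-smallMissing {X = X} k≤n ∣X∣≡k)))
      (∈-filter⁺ (T? ∘ not ∘ memB X) (∈-map⁺ suc (∈-upTo⁺ y≤k)) (¬T⇒T-not y∉X))

-- The values of a

-- The decision list of rules (1)–(6) with its five tests as arguments: `a k X x y` unfolds to
-- `cascade (inFB k X x y) (maxS X <ᵇ x) (rule₃ x y) (memB X y) (rule₅ x y)`.  Tests that a lemma's
-- hypotheses leave unconstrained cannot be inferred and are passed explicitly in `Rules`.
cascade : Bool → Bool → Bool → Bool → Bool → Val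
cascade r₁ r₂ r₃ r₄ r₅ =
  if r₁ then v1 else if r₂ then v0 else if r₃ then v* else if r₄ then v0 else if r₅ then v0 else v*

cascade≡v1 : ∀ {r₁ r₂ r₃ r₄ r₅} → T r₁ → cascade r₁ r₂ r₃ r₄ r₅ ≡ v1
cascade≡v1 {true} _ = refl

cascade≡v1⇒ : ∀ {r₁ r₂ r₃ r₄ r₅} → cascade r₁ r₂ r₃ r₄ r₅ ≡ v1 → T r₁
cascade≡v1⇒ {true}                                   _  = _
cascade≡v1⇒ {false} {true}                           ()
cascade≡v1⇒ {false} {false} {true}                   ()
cascade≡v1⇒ {false} {false} {false} {true}           ()
cascade≡v1⇒ {false} {false} {false} {false} {true}  ()
cascade≡v1⇒ {false} {false} {false} {false} {false} ()

cascade≡v0 : ∀ {r₁ r₂ r₃ r₄ r₅} → ¬ T r₁ → ¬ T r₃ → T r₄ ⊎ T r₅ → cascade r₁ r₂ r₃ r₄ r₅ ≡ v0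
cascade≡v0 {true}                                   ¬r₁ _   _        = contradiction _ ¬r₁
cascade≡v0 {false} {true}                           _   _   _        = refl
cascade≡v0 {false} {false} {true}                   _   ¬r₃ _        = contradiction _ ¬r₃
cascade≡v0 {false} {false} {false} {true}           _   _   _        = refl
cascade≡v0 {false} {false} {false} {false} {true}  _   _   _        = refl
cascade≡v0 {false} {false} {false} {false} {false} _   _   (inj₁ ())
cascade≡v0 {false} {false} {false} {false} {false} _   _   (inj₂ ())

cascade≡v*₃ : ∀ {r₁ r₂ r₃ r₄ r₅} → ¬ T r₁ → ¬ T r₂ → T r₃ → cascade r₁ r₂ r₃ r₄ r₅ ≡ v*
cascade≡v*₃ {true}                 ¬r₁ _   _ = contradiction _ ¬r₁
cascade≡v*₃ {false} {true}         _   ¬r₂ _ = contradiction _ ¬r₂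
cascade≡v*₃ {false} {false} {true} _   _   _ = refl

cascade≡v*₆ : ∀ {r₁ r₂ r₃ r₄ r₅} → ¬ T r₁ → ¬ T r₂ → ¬ T r₄ → ¬ T r₅ → cascade r₁ r₂ r₃ r₄ r₅ ≡ v*
cascade≡v*₆ {true}                                   ¬r₁ _   _   _   = contradiction _ ¬r₁
cascade≡v*₆ {false} {true}                           _   ¬r₂ _   _   = contradiction _ ¬r₂
cascade≡v*₆ {false} {false} {true}                   _   _   _   _   = refl
cascade≡v*₆ {false} {false} {false} {true}           _   _   ¬r₄ _   = contradiction _ ¬r₄
cascade≡v*₆ {false} {false} {false} {false} {true}  _   _   _   ¬r₅ = contradiction _ ¬r₅
cascade≡v*₆ {false} {false} {false} {false} {false} _   _   _   _   = refl

v*≢v0 : v* ≢ v0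
v*≢v0 ()

module Rules {n} (k : ℕ) (X : Subset n) where

  open Matching k X

  rule₃ rule₅ : ℕ → ℕ → Bool
  rule₃ x y = any (λ p → (proj₁ p ≡ᵇ x) ∧ (proj₂ p <ᵇ y)) (f k X)
  rule₅ x y = any (λ p → (proj₂ p ≡ᵇ y) ∧ (proj₁ p <ᵇ x)) (f k X)

  inFB⇒∈ : T (inFB k X x y) → (x , y) ∈ f k X
  inFB⇒∈ {x} {y} t = Any.map pairEq⇒≡ (any⁻ _ (f k X) t)
    where
    pairEq⇒≡ : ∀ {p} → T (pairEqB (x , y) p) → (x , y) ≡ p
    pairEq⇒≡ {x′ , y′} t with x≡x′ , y≡y′ ← Equivalence.to T-∧ t = cong₂ _,_ (≡ᵇ⇒≡ x x′ x≡x′) (≡ᵇ⇒≡ y y′ y≡y′)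

  ∈⇒inFB : (x , y) ∈ f k X → T (inFB k X x y)
  ∈⇒inFB {x} {y} p = any⁺ _ (lose p (Equivalence.from T-∧ (≡⇒≡ᵇ x x refl , ≡⇒≡ᵇ y y refl)))

  rule₃⇒ : T (rule₃ x y) → ∃ λ z → (x , z) ∈ f k X × z < y
  rule₃⇒ {x} {y} t with (x′ , z) , p , t′ ← find (any⁻ _ (f k X) t)
    with x′≡x , z<y ← Equivalence.to T-∧ t′ with refl ← ≡ᵇ⇒≡ x′ x x′≡x = z , p , <ᵇ⇒< z y z<y

  ⇒rule₃ : (x , z) ∈ f k X → z < y → T (rule₃ x y)
  ⇒rule₃ {x} p z<y = any⁺ _ (lose p (Equivalence.from T-∧ (≡⇒≡ᵇ x x refl , <⇒<ᵇ z<y)))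

  rule₅⇒ : T (rule₅ x y) → ∃ λ z → (z , y) ∈ f k X × z < x
  rule₅⇒ {x} {y} t with (z , y′) , p , t′ ← find (any⁻ _ (f k X) t)
    with y′≡y , z<x ← Equivalence.to T-∧ t′ with refl ← ≡ᵇ⇒≡ y′ y y′≡y = z , p , <ᵇ⇒< z x z<x

  ⇒rule₅ : (z , y) ∈ f k X → z < x → T (rule₅ x y)
  ⇒rule₅ {y = y} p z<x = any⁺ _ (lose p (Equivalence.from T-∧ (≡⇒≡ᵇ y y refl , <⇒<ᵇ z<x)))

  ¬maxS<ᵇ : (x , y) ∈ f k X → x′ ≤ x → ¬ T (maxS X <ᵇ x′)
  ¬maxS<ᵇ p x′≤x t = <⇒≱ (<ᵇ⇒< _ _ t) (≤-trans x′≤x (memB⇒≤maxS {X = X} (proj₂ (source p))))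

  a≡v1 : ∀ {x y} → (x , y) ∈ f k X → a k X x y ≡ v1
  a≡v1 {x} {y} p = cascade≡v1 {r₂ = maxS X <ᵇ x} {rule₃ x y} {memB X y} {rule₅ x y} (∈⇒inFB p)

  a≡v1⇒ : ∀ {x y} → a k X x y ≡ v1 → (x , y) ∈ f k X
  a≡v1⇒ {x} {y} eq = inFB⇒∈ (cascade≡v1⇒ {inFB k X x y} {maxS X <ᵇ x} {rule₃ x y} {memB X y} {rule₅ x y} eq)

  a≡v0 : ∀ {x y} → (x , y) ∉ f k X → ¬ (∃ λ z → (x , z) ∈ f k X × z < y) →
         T (memB X y) ⊎ (∃ λ z → (z , y) ∈ f k X × z < x) → a k X x y ≡ v0
  a≡v0 {x} {y} xy∉ ¬rule₃ rule₄⊎rule₅ = cascade≡v0 {r₂ = maxS X <ᵇ x} (xy∉ ∘ inFB⇒∈) (¬rule₃ ∘ rule₃⇒)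
    (Sum.map₂ (λ (_ , p , z<x) → ⇒rule₅ p z<x) rule₄⊎rule₅)

  a≡v*₃ : ∀ {x y z} → (x , z) ∈ f k X → z < y → a k X x y ≡ v*
  a≡v*₃ {x} {y} p z<y = cascade≡v*₃ {r₄ = memB X y} {rule₅ x y}
    (λ t → <-irrefl (functional p (inFB⇒∈ t)) z<y) (¬maxS<ᵇ p ≤-refl) (⇒rule₃ p z<y)

  a≡v*₆ : ∀ {x y x′} → (x′ , y) ∈ f k X → x < x′ → a k X x y ≡ v*
  a≡v*₆ {x} {y} p x<x′ = cascade≡v*₆ {r₃ = rule₃ x y}
    (λ t → <-irrefl (injective (inFB⇒∈ t) p) x<x′) (¬maxS<ᵇ p (<⇒≤ x<x′)) (proj₂ (proj₂ (target p)))
    (λ t → let (z , q , z<x) = rule₅⇒ t in <-asym x<x′ (subst (_< _) (injective q p) z<x))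

-- Edges and paths

edge : ℕ → ℕ → ℕ × ℕ
edge u v = (u ⊔ v , u ⊓ v)

edge-comm : ∀ u v → edge u v ≡ edge v u
edge-comm u v = cong₂ _,_ (⊔-comm u v) (⊓-comm u v)

endpoint-of-edge : ∀ u v → u ≡ u ⊔ v ⊎ u ≡ u ⊓ v
endpoint-of-edge u v with ≤-total u v
... | inj₁ u≤v = inj₂ (sym (m≤n⇒m⊓n≡m u≤v))
... | inj₂ v≤u = inj₁ (sym (m≥n⇒m⊔n≡m v≤u))

endpoint-sel : ∀ {u v} → z ≡ x ⊎ z ≡ y → (x , y) ≡ edge u v → z ≡ u ⊎ z ≡ v
endpoint-sel {u = u} {v} (inj₁ refl) refl = ⊔-sel u v
endpoint-sel {u = u} {v} (inj₂ refl) refl = ⊓-sel u v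

Opposite : ℕ → ℕ → ℕ → Set
Opposite k u v = (k < u × v ≤ k) ⊎ (u ≤ k × k < v)

edge-opposite : ∀ {u v} → k < u ⊔ v → u ⊓ v ≤ k → Opposite k u v
edge-opposite {k} {u} {v} k<u⊔v u⊓v≤k with ≤-total u v
... | inj₁ u≤v = inj₂ (subst (_≤ k) (m≤n⇒m⊓n≡m u≤v) u⊓v≤k , subst (k <_) (m≤n⇒m⊔n≡n u≤v) k<u⊔v)
... | inj₂ v≤u = inj₁ (subst (k <_) (m≥n⇒m⊔n≡m v≤u) k<u⊔v , subst (_≤ k) (m≥n⇒m⊓n≡n v≤u) u⊓v≤k)

opposite-sym : ∀ {k u v} → Opposite k u v → Opposite k v u
opposite-sym (inj₁ (k<u , v≤k)) = inj₂ (v≤k , k<u)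
opposite-sym (inj₂ (u≤k , k<v)) = inj₁ (k<v , u≤k)

module _ {k u v : ℕ} where

  big⇒small : Opposite k u v → k < u → v ≤ k
  big⇒small (inj₁ (_ , v≤k)) _   = v≤k
  big⇒small (inj₂ (u≤k , _)) k<u = contradiction u≤k (<⇒≱ k<u)

  small⇒big : Opposite k u v → u ≤ k → k < v
  small⇒big (inj₁ (k<u , _)) u≤k = contradiction u≤k (<⇒≱ k<u)
  small⇒big (inj₂ (_ , k<v)) _   = k<v

  edge-big-small : k < u → v ≤ k → edge u v ≡ (u , v)
  edge-big-small k<u v≤k = cong₂ _,_ (m≥n⇒m⊔n≡m v≤u) (m≥n⇒m⊓n≡n v≤u)
    where v≤u = ≤-trans v≤k (<⇒≤ k<u)

  edge-small-big : u ≤ k → k < v → edge u v ≡ (v , u)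
  edge-small-big u≤k k<v = cong₂ _,_ (m≤n⇒m⊔n≡n u≤v) (m≤n⇒m⊓n≡m u≤v)
    where u≤v = ≤-trans u≤k (<⇒≤ k<v)

module _ {n} (k : ℕ) (X : Subset n) where

  open Matching k X

  edge-opposite-∈ : ∀ {u v} → edge u v ∈ f k X → Opposite k u v
  edge-opposite-∈ uv = let k<u⊔v , u⊓v≤k = sides uv in edge-opposite k<u⊔v u⊓v≤k

  consecutive-edges : ∀ {t u v} → edge t u ∈ f k X → edge u v ∈ f k X → t ≡ v
  consecutive-edges tu uv with edge-opposite-∈ tu
  ... | inj₁ (k<t , u≤k) = injective (subst (_∈ f k X) (edge-big-small k<t u≤k) tu)
                              (subst (_∈ f k X) (edge-small-big u≤k (small⇒big (edge-opposite-∈ uv) u≤k)) uv)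
  ... | inj₂ (t≤k , k<u) = functional (subst (_∈ f k X) (edge-small-big t≤k k<u) tu)
                              (subst (_∈ f k X) (edge-big-small k<u (big⇒small (edge-opposite-∈ uv) k<u)) uv)

Adjacent : List ℕ → ℕ → ℕ → Set
Adjacent C u v = ∃₂ λ ys zs → C ≡ ys ++ u ∷ v ∷ zs

module _ {C : List ℕ} {u v : ℕ} where

  adjacent⇒∈ˡ : Adjacent C u v → u ∈ C
  adjacent⇒∈ˡ (ys , _ , refl) = ∈-++⁺ʳ ys (here refl)

  adjacent⇒∈ʳ : Adjacent C u v → v ∈ C
  adjacent⇒∈ʳ (ys , _ , refl) = ∈-++⁺ʳ ys (there (here refl))

  edge⇒∈ : Adjacent C u v → (x , y) ≡ edge u v → x ∈ C × y ∈ C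
  edge⇒∈ adj refl = endpoint (⊔-sel u v) , endpoint (⊓-sel u v)
    where
    endpoint : z ≡ u ⊎ z ≡ v → z ∈ C
    endpoint (inj₁ refl) = adjacent⇒∈ˡ adj
    endpoint (inj₂ refl) = adjacent⇒∈ʳ adj

reverse-++-++ : ∀ (ys vs zs : List A) → reverse (ys ++ vs ++ zs) ≡ reverse zs ++ reverse vs ++ reverse ys
reverse-++-++ ys vs zs = begin
  reverse (ys ++ vs ++ zs)              ≡⟨ reverse-++ ys (vs ++ zs) ⟩
  reverse (vs ++ zs) ++ reverse ys       ≡⟨ cong (_++ reverse ys) (reverse-++ vs zs) ⟩
  (reverse zs ++ reverse vs) ++ reverse ys ≡⟨ ++-assoc (reverse zs) (reverse vs) (reverse ys) ⟩
  reverse zs ++ reverse vs ++ reverse ys  ∎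
  where open ≡-Reasoning

adjacent-reverse : ∀ {C u v} → Adjacent C u v → Adjacent (reverse C) v u
adjacent-reverse {u = u} {v} (ys , zs , refl) = reverse zs , reverse ys , reverse-++-++ ys (u ∷ v ∷ []) zs

adjacent-reverse⁻ : ∀ {C u v} → Adjacent (reverse C) u v → Adjacent C v u
adjacent-reverse⁻ {C} adj = subst (λ D → Adjacent D _ _) (reverse-involutive C) (adjacent-reverse adj)

snoc-split : ∀ (ys : List ℕ) u vs → ys ++ u ∷ vs ≡ (ys ∷ʳ u) ++ vs
snoc-split ys u vs = sym (++-assoc ys (u ∷ []) vs)

split-unique : ∀ {v : ℕ} {zs zs′} ys ys′ → Unique (ys ++ v ∷ zs) → ys ++ v ∷ zs ≡ ys′ ++ v ∷ zs′ → ys ≡ ys′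
split-unique []       []        _        _  = refl
split-unique {v} []   (_ ∷ ys′) (v∉ ∷ _) eq with refl , eq′ ← ∷-injective eq =
  contradiction refl (All.lookup v∉ (subst (v ∈_) (sym eq′) (∈-++⁺ʳ ys′ (here refl))))
split-unique (_ ∷ ys) []        (v∉ ∷ _) eq with refl , _ ← ∷-injective eq =
  contradiction refl (All.lookup v∉ (∈-++⁺ʳ ys (here refl)))
split-unique (y ∷ ys) (_ ∷ ys′) (_ ∷ u!) eq with refl , eq′ ← ∷-injective eq =
  cong (y ∷_) (split-unique ys ys′ u! eq′)

module _ {C : List ℕ} (C! : Unique C) where

  adjacent-functional : ∀ {u v v′} → Adjacent C u v → Adjacent C u v′ → v ≡ v′
  adjacent-functional (ys , zs , refl) (ys′ , zs′ , eq) with refl ← split-unique ys ys′ C! eq =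
    proj₁ (∷-injective (∷-injectiveʳ (++-cancelˡ ys _ _ eq)))

  adjacent-injective : ∀ {u u′ v} → Adjacent C u v → Adjacent C u′ v → u ≡ u′
  adjacent-injective {u} {u′} {v} (ys , zs , refl) (ys′ , zs′ , eq) =
    ∷ʳ-injectiveʳ ys ys′ (split-unique (ys ∷ʳ u) (ys′ ∷ʳ u′) (subst Unique (snoc-split ys u (v ∷ zs)) C!)
      (trans (sym (snoc-split ys u (v ∷ zs))) (trans eq (snoc-split ys′ u′ (v ∷ zs′)))))

no-predecessor : ∀ {w C u} → Unique (w ∷ C) → ¬ Adjacent (w ∷ C) u w
no-predecessor (w∉ ∷ _) ([] , zs , eq) =
  All.lookup w∉ (subst (_ ∈_) (sym (∷-injectiveʳ eq)) (here refl)) refl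
no-predecessor (w∉ ∷ _) (_ ∷ ys , zs , eq) =
  All.lookup w∉ (subst (_ ∈_) (sym (∷-injectiveʳ eq)) (∈-++⁺ʳ ys (there (here refl)))) refl

successor-of-second : ∀ {w₀ w₁ rest u} → Unique (w₀ ∷ w₁ ∷ rest) → Adjacent (w₀ ∷ w₁ ∷ rest) w₁ u →
                      ∃ λ r → rest ≡ u ∷ r
successor-of-second {w₀} C! (ys , zs , eq) with refl ← split-unique (w₀ ∷ []) ys C! eq =
  zs , ∷-injectiveʳ (∷-injectiveʳ eq)

∈-pathEdges⁺ : ∀ {u v zs} ys → edge u v ∈ pathEdges (ys ++ u ∷ v ∷ zs)
∈-pathEdges⁺ []           = here refl
∈-pathEdges⁺ (_ ∷ [])     = there (here refl)
∈-pathEdges⁺ (_ ∷ y ∷ ys) = there (∈-pathEdges⁺ (y ∷ ys))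

∈-pathEdges⁻ : ∀ {e} C → e ∈ pathEdges C → ∃₂ λ u v → Adjacent C u v × e ≡ edge u v
∈-pathEdges⁻ (u ∷ v ∷ _) (here refl) = u , v , ([] , _ , refl) , refl
∈-pathEdges⁻ (w ∷ v ∷ C) (there e∈) with u , u′ , (ys , zs , eq) , refl ← ∈-pathEdges⁻ (v ∷ C) e∈ =
  u , u′ , (w ∷ ys , zs , cong (w ∷_) eq) , refl

pathEdges-unique : ∀ {C} → Unique C → Unique (pathEdges C)
pathEdges-unique {[]}             _          = []
pathEdges-unique {_ ∷ []}         _          = []
pathEdges-unique {v ∷ w ∷ C} (v∉ ∷ w∷C!) = All.tabulate new ∷ pathEdges-unique w∷C!
  where
  new : ∀ {e} → e ∈ pathEdges (w ∷ C) → edge v w ≢ e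
  new e∈ eq with u , u′ , adj , refl ← ∈-pathEdges⁻ (w ∷ C) e∈ with x∈ , y∈ ← edge⇒∈ adj eq
    with endpoint-of-edge v w
  ... | inj₁ v≡x = All.lookup v∉ (subst (_∈ w ∷ C) (sym v≡x) x∈) refl
  ... | inj₂ v≡y = All.lookup v∉ (subst (_∈ w ∷ C) (sym v≡y) y∈) refl

unique-++-disjoint : ∀ {e : A} {ws ws′} → Unique (ws ++ ws′) → e ∈ ws → e ∈ ws′ → ⊥
unique-++-disjoint {ws = _ ∷ ws} (e∉ ∷ _) (here refl) e∈′ = All.lookup e∉ (∈-++⁺ʳ ws e∈′) refl
unique-++-disjoint {ws = _ ∷ _} (_ ∷ !) (there e∈) e∈′ = unique-++-disjoint ! e∈ e∈′

Unique-resp-↭ : ∀ {ws ws′ : List A} → ws ↭ ws′ → Unique ws → Unique ws′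
Unique-resp-↭ ws↭ws′ = ↭ₛ.Unique-resp-↭ (≡.setoid _) (↭⇒↭ₛ ws↭ws′)

-- The consequences of `PathComponent (E₁ ++ E₂) C` used below; unlike the definition, they are
-- invariant under reversing C and under swapping E₁ and E₂.
record ComponentPath (E₁ E₂ : List (ℕ × ℕ)) (C : List ℕ) : Set where
  field
    unique        : Unique C
    adjacent⇒edge : ∀ {u v} → Adjacent C u v → edge u v ∈ E₁ ++ E₂
    edge⇒adjacent : ∀ {x y} → (x , y) ∈ E₁ ++ E₂ → x ∈ C ⊎ y ∈ C →
                    ∃₂ λ u v → Adjacent C u v × (x , y) ≡ edge u v
    simple        : ∀ {x y} → (x , y) ∈ E₁ → (x , y) ∈ E₂ → x ∈ C → ⊥

module _ {E₁ E₂ : List (ℕ × ℕ)} {C : List ℕ} (pc : PathComponent (E₁ ++ E₂) C) where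

  open PathComponent pc

  private
    touchesᵇ : ℕ × ℕ → Bool
    touchesᵇ e = any (λ v → (proj₁ e ≡ᵇ v) ∨ (proj₂ e ≡ᵇ v)) C

    touches : x ∈ C ⊎ y ∈ C → T (touchesᵇ (x , y))
    touches {x} (inj₁ x∈C) = any⁺ _ (lose x∈C (Equivalence.from T-∨ (inj₁ (≡⇒≡ᵇ x x refl))))
    touches {y = y} (inj₂ y∈C) = any⁺ _ (lose y∈C (Equivalence.from T-∨ (inj₂ (≡⇒≡ᵇ y y refl))))

    incident⁺ : ∀ {E} → (x , y) ∈ E → x ∈ C ⊎ y ∈ C → (x , y) ∈ incident E C
    incident⁺ e∈ touch = ∈-filter⁺ (T? ∘ touchesᵇ) e∈ (touches touch)

  pathComponent⇒componentPath : ComponentPath E₁ E₂ C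
  pathComponent⇒componentPath = record
    { unique        = distinct
    ; adjacent⇒edge = λ { (ys , _ , refl) →
        proj₁ (∈-filter⁻ (T? ∘ touchesᵇ) {xs = E₁ ++ E₂} (∈-resp-↭ (↭-sym edgesPath) (∈-pathEdges⁺ ys))) }
    ; edge⇒adjacent = λ e∈ touch → ∈-pathEdges⁻ C (∈-resp-↭ edgesPath (incident⁺ e∈ touch))
    ; simple        = λ e∈₁ e∈₂ x∈C → unique-++-disjoint
        (subst Unique (filter-++ (T? ∘ touchesᵇ) E₁ E₂) incident-unique)
        (incident⁺ e∈₁ (inj₁ x∈C)) (incident⁺ e∈₂ (inj₁ x∈C))
    }
    where
    incident-unique : Unique (incident (E₁ ++ E₂) C)
    incident-unique = Unique-resp-↭ (↭-sym edgesPath) (pathEdges-unique distinct)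

module _ {E₁ E₂ : List (ℕ × ℕ)} {C : List ℕ} (path : ComponentPath E₁ E₂ C) where

  open ComponentPath path

  componentPath-swap : ComponentPath E₂ E₁ C
  componentPath-swap = record
    { unique        = unique
    ; adjacent⇒edge = ∈-resp-↭ (↭.++-comm E₁ E₂) ∘ adjacent⇒edge
    ; edge⇒adjacent = edge⇒adjacent ∘ ∈-resp-↭ (↭.++-comm E₂ E₁)
    ; simple        = λ e∈₂ e∈₁ → simple e∈₁ e∈₂
    }

  componentPath-reverse : ComponentPath E₁ E₂ (reverse C)
  componentPath-reverse = record
    { unique        = Unique-resp-↭ (↭-sym (↭-reverse C)) unique
    ; adjacent⇒edge = λ {u} {v} adj →
        subst (_∈ E₁ ++ E₂) (edge-comm v u) (adjacent⇒edge (adjacent-reverse⁻ adj))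
    ; edge⇒adjacent = λ e∈ touch →
        let u , v , adj , e≡ = edge⇒adjacent e∈ (Sum.map reverse⁻ reverse⁻ touch)
        in v , u , adjacent-reverse adj , trans e≡ (edge-comm u v)
    ; simple        = λ e∈₁ e∈₂ → simple e∈₁ e∈₂ ∘ reverse⁻
    }

Receding : ℕ → ℕ → ℕ → Set
Receding k u w = (k < u × w < u) ⊎ (u ≤ k × u < w)

module _ {k u v : ℕ} where

  receding-big : k < u → Receding k u v → v < u
  receding-big _   (inj₁ (_ , v<u)) = v<u
  receding-big k<u (inj₂ (u≤k , _)) = contradiction u≤k (<⇒≱ k<u)

  receding-small : u ≤ k → Receding k u v → u < v
  receding-small u≤k (inj₁ (k<u , _)) = contradiction u≤k (<⇒≱ k<u)
  receding-small _   (inj₂ (_ , u<v)) = u<v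

Windows : (ℕ → ℕ → Set) → List ℕ → Set
Windows R (u ∷ v ∷ w ∷ C) = R u w × Windows R (v ∷ w ∷ C)
Windows R _               = ⊤

Windows-tail : ∀ {v} C → Windows R (v ∷ C) → Windows R C
Windows-tail []              _        = _
Windows-tail (_ ∷ [])        _        = _
Windows-tail (_ ∷ _ ∷ [])    _        = _
Windows-tail (_ ∷ _ ∷ _ ∷ _) (_ , rs) = rs

windows⇒ : ∀ ys {u v w zs} → Windows R (ys ++ u ∷ v ∷ w ∷ zs) → R u w
windows⇒ []       (r , _) = r
windows⇒ (_ ∷ ys) rs      = windows⇒ ys (Windows-tail (ys ++ _) rs)

⇒windows : ∀ {C} → (∀ ys {u v w zs} → C ≡ ys ++ u ∷ v ∷ w ∷ zs → R u w) → Windows R C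
⇒windows {C = []}              _ = _
⇒windows {C = _ ∷ []}          _ = _
⇒windows {C = _ ∷ _ ∷ []}      _ = _
⇒windows {C = u ∷ _ ∷ _ ∷ _} h = h [] refl , ⇒windows (λ ys eq → h (u ∷ ys) (cong (u ∷_) eq))

windows-reverse : ∀ {C} → Windows (flip R) C → Windows R (reverse C)
windows-reverse {R = R} {C = C} rs = ⇒windows λ ys {u} {v} {w} {zs} eq → windows⇒ (reverse zs)
  (subst (Windows (flip R)) (trans (sym (reverse-involutive C))
    (trans (cong reverse eq) (reverse-++-++ ys (u ∷ v ∷ w ∷ []) zs))) rs)

adjacent⇒linked : ∀ C → (∀ {u v} → Adjacent C u v → R u v) → Linked R C
adjacent⇒linked []          _ = []
adjacent⇒linked (_ ∷ [])    _ = [-]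
adjacent⇒linked (u ∷ v ∷ C) h =
  h ([] , C , refl) ∷ adjacent⇒linked (v ∷ C) λ (ys , zs , eq) → h (u ∷ ys , zs , cong (u ∷_) eq)

module TwoMatchings {n} (k : ℕ) (P Q : Subset n) where

  E : List (ℕ × ℕ)
  E = f k P ++ f k Q

  Edge : ℕ → ℕ → Set
  Edge u v = edge u v ∈ E

  sides : (x , y) ∈ E → k < x × y ≤ k
  sides xy with ∈-++⁻ (f k P) xy
  ... | inj₁ xy∈P = Matching.sides k P xy∈P
  ... | inj₂ xy∈Q = Matching.sides k Q xy∈Q

  opposite : ∀ {u v} → Edge u v → Opposite k u v
  opposite uv = let k<u⊔v , u⊓v≤k = sides uv in edge-opposite k<u⊔v u⊓v≤k

  alternating : ∀ {t u v w} → Edge t u → Edge u v → Edge v w → t ≢ v → u ≢ w →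
                ∃ λ X → edge t u ∈ f k X × edge v w ∈ f k X
  alternating tu uv vw t≢v u≢w with ∈-++⁻ (f k P) tu | ∈-++⁻ (f k P) uv | ∈-++⁻ (f k P) vw
  ... | inj₁ tu∈P | inj₁ uv∈P | _         = contradiction (consecutive-edges k P tu∈P uv∈P) t≢v
  ... | inj₂ tu∈Q | inj₂ uv∈Q | _         = contradiction (consecutive-edges k Q tu∈Q uv∈Q) t≢v
  ... | _         | inj₁ uv∈P | inj₁ vw∈P = contradiction (consecutive-edges k P uv∈P vw∈P) u≢w
  ... | _         | inj₂ uv∈Q | inj₂ vw∈Q = contradiction (consecutive-edges k Q uv∈Q vw∈Q) u≢w
  ... | inj₁ tu∈P | inj₂ _    | inj₁ vw∈P = P , tu∈P , vw∈P
  ... | inj₂ tu∈Q | inj₁ _    | inj₂ vw∈Q = Q , tu∈Q , vw∈Q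

  window : ∀ {t u v w} → Edge t u → Edge u v → Edge v w → t ≢ v → u ≢ w →
           (Receding k t v → Receding k u w) × (Receding k v t → Receding k w u)
  window {t} {u} {v} {w} tu uv vw t≢v u≢w with X , tu∈X , vw∈X ← alternating tu uv vw t≢v u≢w | opposite tu
  ... | inj₁ (k<t , u≤k) =
    (λ r → inj₂ (u≤k , antitone vw∈ tu∈ (receding-big k<t r))) ,
    (λ r → inj₂ (w≤k , antitone tu∈ vw∈ (receding-big k<v r)))
    where
    open Matching k X
    k<v = small⇒big (opposite uv) u≤k
    w≤k = big⇒small (opposite vw) k<v
    tu∈ = subst (_∈ f k X) (edge-big-small k<t u≤k) tu∈X
    vw∈ = subst (_∈ f k X) (edge-big-small k<v w≤k) vw∈X
  ... | inj₂ (t≤k , k<u) =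
    (λ r → inj₁ (k<u , antitone⁻ tu∈ vw∈ (receding-small t≤k r))) ,
    (λ r → inj₁ (k<w , antitone⁻ vw∈ tu∈ (receding-small v≤k r)))
    where
    open Matching k X
    v≤k = big⇒small (opposite uv) k<u
    k<w = small⇒big (opposite vw) v≤k
    tu∈ = subst (_∈ f k X) (edge-small-big t≤k k<u) tu∈X
    vw∈ = subst (_∈ f k X) (edge-small-big v≤k k<w) vw∈X

  receding-either : ∀ {t u v} → Edge t u → Edge u v → t ≢ v → Receding k t v ⊎ Receding k v t
  receding-either {t} {v = v} tu uv t≢v with opposite tu | <-cmp t v
  ... | _ | tri≈ _ t≡v _ = contradiction t≡v t≢v
  ... | inj₁ (k<t , u≤k) | tri< t<v _ _ = inj₂ (inj₁ (small⇒big (opposite uv) u≤k , t<v))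
  ... | inj₁ (k<t , _)   | tri> _ _ v<t = inj₁ (inj₁ (k<t , v<t))
  ... | inj₂ (t≤k , _)   | tri< t<v _ _ = inj₁ (inj₂ (t≤k , t<v))
  ... | inj₂ (_ , k<u)   | tri> _ _ v<t = inj₂ (inj₂ (big⇒small (opposite uv) k<u , v<t))

  receding-edges : ∀ {t u v} → Edge t u → Edge u v → Receding k t v → u ⊔ v ≤ t ⊔ u × t ⊓ u ≤ u ⊓ v
  receding-edges {t} {u} tu uv r with opposite tu
  ... | inj₁ (k<t , u≤k) =
    ⊔-lub (m≤n⊔m t u) (≤-trans (<⇒≤ (receding-big k<t r)) (m≤m⊔n t u)) ,
    ⊓-glb (m⊓n≤n t u) (≤-trans (m⊓n≤n t u) (≤-trans u≤k (<⇒≤ (small⇒big (opposite uv) u≤k))))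
  ... | inj₂ (t≤k , k<u) =
    ⊔-lub (m≤n⊔m t u) (≤-trans (≤-trans (big⇒small (opposite uv) k<u) (<⇒≤ k<u)) (m≤n⊔m t u)) ,
    ⊓-glb (m⊓n≤n t u) (≤-trans (m⊓n≤m t u) (<⇒≤ (receding-small t≤k r)))

  propagate : (∀ {t u v w} → Edge t u → Edge u v → Edge v w → t ≢ v → u ≢ w → R t v → R u w) →
              ∀ {t u v rest} → Linked Edge (t ∷ u ∷ v ∷ rest) → Unique (t ∷ u ∷ v ∷ rest) → R t v →
              Windows R (t ∷ u ∷ v ∷ rest)
  propagate step {rest = []}    _                     _                r = r , _
  propagate step {rest = _ ∷ _} (tu ∷ uv ∷ vw ∷ links) (t∉ ∷ u∉ ∷ vs!) r =
    r , propagate step (uv ∷ vw ∷ links) (u∉ ∷ vs!)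
          (step tu uv vw (All.lookup t∉ (there (here refl))) (All.lookup u∉ (there (here refl))) r)

  extremal : ∀ {t u} rest → Linked Edge (t ∷ u ∷ rest) → Windows (Receding k) (t ∷ u ∷ rest) →
             ∀ {v} → v ∈ t ∷ u ∷ rest → (k < v → v ≤ t ⊔ u) × (v ≤ k → t ⊓ u ≤ v)
  extremal _ _ _ (here refl)         = (λ _ → m≤m⊔n _ _) , (λ _ → m⊓n≤m _ _)
  extremal _ _ _ (there (here refl)) = (λ _ → m≤n⊔m _ _) , (λ _ → m⊓n≤n _ _)
  extremal (_ ∷ rest) (tu ∷ links) (r , rs) (there (there v∈))
    with upper , lower ← extremal rest links rs (there v∈)
       | ⊔≤⊔ , ⊓≤⊓ ← receding-edges tu (Linked.head links) r =
    (λ k<v → ≤-trans (upper k<v) ⊔≤⊔) , (λ v≤k → ≤-trans ⊓≤⊓ (lower v≤k))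

record Orientation {n} (k : ℕ) (P Q : Subset n) (C : List ℕ) : Set where
  field
    w₀ w₁    : ℕ
    rest     : List ℕ
    path     : ComponentPath (f k P) (f k Q) (w₀ ∷ w₁ ∷ rest)
    receding : Windows (Receding k) (w₀ ∷ w₁ ∷ rest)
    ⊆C       : ∀ {v} → v ∈ w₀ ∷ w₁ ∷ rest → v ∈ C
    ⊇C       : ∀ {v} → v ∈ C → v ∈ w₀ ∷ w₁ ∷ rest

module _ {n} {k : ℕ} {P Q : Subset n} where

  open TwoMatchings k P Q

  private
    listing : ∀ {C} D → ComponentPath (f k P) (f k Q) D → Windows (Receding k) D → 2 ≤ length D →
              (∀ {v} → v ∈ D → v ∈ C) → (∀ {v} → v ∈ C → v ∈ D) → Orientation k P Q C
    listing (_ ∷ []) _ _ (s≤s ()) _ _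
    listing (w₀ ∷ w₁ ∷ rest) path receding _ ⊆C ⊇C = record
      { w₀ = w₀ ; w₁ = w₁ ; rest = rest ; path = path ; receding = receding ; ⊆C = ⊆C ; ⊇C = ⊇C }

  orientation : ∀ {C} → ComponentPath (f k P) (f k Q) C → 2 ≤ length C → Orientation k P Q C
  orientation {_ ∷ []} _ (s≤s ())
  orientation {w₀ ∷ w₁ ∷ []} path 2≤∣C∣ = listing _ path _ 2≤∣C∣ id id
  orientation {C@(w₀ ∷ w₁ ∷ w₂ ∷ rest)} path 2≤∣C∣ = orient (receding-either tu uv w₀≢w₂)
    where
    open ComponentPath path
    links = adjacent⇒linked C adjacent⇒edge
    tu = Linked.head links
    uv = Linked.head (Linked.tail links)
    w₀≢w₂ = All.lookup (AllPairs.head unique) (there (here refl))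
    orient : Receding k w₀ w₂ ⊎ Receding k w₂ w₀ → Orientation k P Q C
    orient (inj₁ r) = listing C path
      (propagate (λ e₁ e₂ e₃ d₁ d₂ → proj₁ (window e₁ e₂ e₃ d₁ d₂)) links unique r) 2≤∣C∣ id id
    orient (inj₂ r) = listing (reverse C) (componentPath-reverse path)
      (windows-reverse (propagate (λ e₁ e₂ e₃ d₁ d₂ → proj₂ (window e₁ e₂ e₃ d₁ d₂)) links unique r))
      (subst (2 ≤_) (sym (length-reverse C)) 2≤∣C∣) reverse⁻ reverse⁺

-- The head edge

module HeadEdge {n k : ℕ} (k≤n : k ≤ n) {P Q : Subset n} (∣P∣≡k : ∣ P ∣ ≡ k)
  {w₀ w₁ : ℕ} {rest : List ℕ} (path : ComponentPath (f k P) (f k Q) (w₀ ∷ w₁ ∷ rest))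
  (receding : Windows (Receding k) (w₀ ∷ w₁ ∷ rest)) where

  open ComponentPath path
  open TwoMatchings k P Q
  private
    module MP = Matching k P
    module MQ = Matching k Q
    module RP = Rules k P

  C : List ℕ
  C = w₀ ∷ w₁ ∷ rest

  head-adjacent : Adjacent C w₀ w₁
  head-adjacent = [] , rest , refl

  first-window : ∀ {w₂ r} → rest ≡ w₂ ∷ r → Receding k w₀ w₂
  first-window refl = proj₁ receding

  neighbour : (x , y) ∈ E → z ≡ x ⊎ z ≡ y → z ∈ C →
              ∃ λ u → (Adjacent C u z ⊎ Adjacent C z u) × (x , y) ≡ edge z u
  neighbour e∈ z≡x⊎y z∈C
    with u , v , adj , xy≡ ← edge⇒adjacent e∈ (Sum.map (λ { refl → z∈C }) (λ { refl → z∈C }) z≡x⊎y)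
    with endpoint-sel z≡x⊎y xy≡
  ... | inj₁ refl = v , inj₂ adj , xy≡
  ... | inj₂ refl = u , inj₁ adj , trans xy≡ (edge-comm u _)

  neighbour-of-w₀ : (x , y) ∈ E → w₀ ≡ x ⊎ w₀ ≡ y → (x , y) ≡ edge w₀ w₁
  neighbour-of-w₀ e∈ w₀≡x⊎y with neighbour e∈ w₀≡x⊎y (here refl)
  ... | _ , inj₁ adj , _   = contradiction adj (no-predecessor unique)
  ... | _ , inj₂ adj , xy≡ = trans xy≡ (cong (edge w₀) (adjacent-functional unique adj head-adjacent))

  neighbour-of-w₁ : (x , y) ∈ E → w₁ ≡ x ⊎ w₁ ≡ y →
                    (x , y) ≡ edge w₁ w₀ ⊎ ∃₂ λ w₂ r → rest ≡ w₂ ∷ r × (x , y) ≡ edge w₁ w₂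
  neighbour-of-w₁ e∈ w₁≡x⊎y with neighbour e∈ w₁≡x⊎y (there (here refl))
  ... | _ , inj₁ adj , xy≡ = inj₁ (trans xy≡ (cong (edge w₁) (adjacent-injective unique adj head-adjacent)))
  ... | u , inj₂ adj , xy≡ = let r , rest≡ = successor-of-second unique adj in inj₂ (u , r , rest≡ , xy≡)

  a≡v0-at-big-head : k < w₀ → w₁ ≤ k → (w₀ , w₁) ∈ f k Q → a k P w₀ w₁ ≡ v0
  a≡v0-at-big-head k<w₀ w₁≤k q = RP.a≡v0 (λ p → simple p q (here refl)) no-rule₃ rule₄⊎rule₅
    where
    head≡ : edge w₀ w₁ ≡ (w₀ , w₁)
    head≡ = edge-big-small k<w₀ w₁≤k
    no-rule₃ : ¬ (∃ λ z → (w₀ , z) ∈ f k P × z < w₁)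
    no-rule₃ (z , p , z<w₁) = <-irrefl (cong proj₂ (trans (neighbour-of-w₀ (∈-++⁺ˡ p) (inj₁ refl)) head≡)) z<w₁
    rule₄⊎rule₅ : T (memB P w₁) ⊎ ∃ λ z → (z , w₁) ∈ f k P × z < w₀
    rule₄⊎rule₅ with T? (memB P w₁)
    ... | yes w₁∈P = inj₁ w₁∈P
    ... | no  w₁∉P with x , p ← MP.complete k≤n ∣P∣≡k (proj₁ (MQ.target q)) w₁≤k w₁∉P
      with neighbour-of-w₁ (∈-++⁺ˡ p) (inj₂ refl)
    ...   | inj₁ xw₁≡ =
      contradiction (subst (_∈ f k P) (trans xw₁≡ (trans (edge-comm w₁ w₀) head≡)) p)
        (λ p → simple p q (here refl))
    ...   | inj₂ (w₂ , _ , rest≡ , xw₁≡) = inj₂ (x , p , subst (_< w₀) (sym (cong proj₁ xw₁≡))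
      (⊔-pres-<m (≤-<-trans w₁≤k k<w₀) (receding-big k<w₀ (first-window rest≡))))

  a≡v0-at-small-head : w₀ ≤ k → k < w₁ → (w₁ , w₀) ∈ f k Q → a k P w₁ w₀ ≡ v0
  a≡v0-at-small-head w₀≤k k<w₁ q = RP.a≡v0 (λ p → simple p q (there (here refl))) no-rule₃ (inj₁ w₀∈P)
    where
    head≡ : edge w₀ w₁ ≡ (w₁ , w₀)
    head≡ = edge-small-big w₀≤k k<w₁
    no-rule₃ : ¬ (∃ λ z → (w₁ , z) ∈ f k P × z < w₀)
    no-rule₃ (z , p , z<w₀) with neighbour-of-w₁ (∈-++⁺ˡ p) (inj₁ refl)
    ... | inj₁ w₁z≡ = <-irrefl (cong proj₂ (trans w₁z≡ (trans (edge-comm w₁ w₀) head≡))) z<w₀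
    ... | inj₂ (w₂ , _ , rest≡ , w₁z≡) = <-asym z<w₀ (subst (w₀ <_) (sym (cong proj₂ w₁z≡))
      (⊓-pres-m< (≤-<-trans w₀≤k k<w₁) (receding-small w₀≤k (first-window rest≡))))
    w₀∈P : T (memB P w₀)
    w₀∈P with T? (memB P w₀)
    ... | yes w₀∈P = w₀∈P
    ... | no  w₀∉P with x , p ← MP.complete k≤n ∣P∣≡k (proj₁ (MQ.target q)) w₀≤k w₀∉P =
      contradiction (subst (_∈ f k P) (trans (neighbour-of-w₀ (∈-++⁺ˡ p) (inj₂ refl)) head≡) p)
        (λ p → simple p q (there (here refl)))

  a≡v0-at-head : (x , y) ≡ edge w₀ w₁ → (x , y) ∈ f k Q → a k P x y ≡ v0
  a≡v0-at-head xy≡ q with opposite (adjacent⇒edge head-adjacent)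
  ... | inj₁ (k<w₀ , w₁≤k) with refl ← trans xy≡ (edge-big-small k<w₀ w₁≤k) = a≡v0-at-big-head k<w₀ w₁≤k q
  ... | inj₂ (w₀≤k , k<w₁) with refl ← trans xy≡ (edge-small-big w₀≤k k<w₁) = a≡v0-at-small-head w₀≤k k<w₁ q

  module Inner (ys : List ℕ) {t u v : ℕ} {zs : List ℕ} (C≡ : C ≡ ys ++ t ∷ u ∷ v ∷ zs) where

    tu : Edge t u
    tu = adjacent⇒edge (ys , v ∷ zs , C≡)

    r : Receding k t v
    r = windows⇒ ys (subst (Windows (Receding k)) C≡ receding)

    t≤k : k < u → t ≤ k
    t≤k = big⇒small (opposite-sym (opposite tu))

    k<t : u ≤ k → k < t
    k<t = small⇒big (opposite-sym (opposite tu))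

    t<v : k < u → t < v
    t<v = λ k<u → receding-small (t≤k k<u) r

    v<t : u ≤ k → v < t
    v<t = λ u≤k → receding-big (k<t u≤k) r

    a≢v0-big : k < u → (u , v) ∈ f k Q → a k P u v ≢ v0
    a≢v0-big k<u q a≡v0 with ∈-++⁻ (f k P) (subst (_∈ E) (edge-small-big (t≤k k<u) k<u) tu)
    ... | inj₁ p  = v*≢v0 (trans (sym (RP.a≡v*₃ p (t<v k<u))) a≡v0)
    ... | inj₂ q′ = <⇒≢ (t<v k<u) (MQ.functional q′ q)

    a≢v0-small : u ≤ k → (v , u) ∈ f k Q → a k P v u ≢ v0
    a≢v0-small u≤k q a≡v0 with ∈-++⁻ (f k P) (subst (_∈ E) (edge-big-small (k<t u≤k) u≤k) tu)
    ... | inj₁ p  = v*≢v0 (trans (sym (RP.a≡v*₆ p (v<t u≤k))) a≡v0)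
    ... | inj₂ q′ = <⇒≢ (v<t u≤k) (sym (MQ.injective q′ q))

  a≡v0⇒head : (x , y) ∈ f k Q → a k P x y ≡ v0 → x ∈ C → (x , y) ≡ edge w₀ w₁
  a≡v0⇒head q a≡v0 x∈C with u , v , (ys , zs , C≡) , xy≡ ← edge⇒adjacent (∈-++⁺ʳ (f k P) q) (inj₁ x∈C)
    with initLast ys
  ... | [] with refl ← C≡ = xy≡
  ... | ys′ ∷ʳ′ t with opposite (adjacent⇒edge (_ , zs , C≡))
  ...   | inj₁ (k<u , v≤k) with refl ← trans xy≡ (edge-big-small k<u v≤k) =
    contradiction a≡v0 (Inner.a≢v0-big ys′ (trans C≡ (sym (snoc-split ys′ t (u ∷ v ∷ zs)))) k<u q)
  ...   | inj₂ (u≤k , k<v) with refl ← trans xy≡ (edge-small-big u≤k k<v) =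
    contradiction a≡v0 (Inner.a≢v0-small ys′ (trans C≡ (sym (snoc-split ys′ t (u ∷ v ∷ zs)))) u≤k q)

module _ {n k : ℕ} {S T : Subset n} {C : List ℕ} (o : Orientation k S T C) where

  open Orientation o
  open ComponentPath path
  open TwoMatchings k S T

  head-edge∈ : edge w₀ w₁ ∈ hEdges k S T
  head-edge∈ = adjacent⇒edge ([] , rest , refl)

  private
    endpoint∈C : z ≡ w₀ ⊎ z ≡ w₁ → z ∈ C
    endpoint∈C (inj₁ refl) = ⊆C (here refl)
    endpoint∈C (inj₂ refl) = ⊆C (there (here refl))

    bounds : ∀ {v} → v ∈ C → (k < v → v ≤ w₀ ⊔ w₁) × (v ≤ k → w₀ ⊓ w₁ ≤ v)
    bounds v∈C = extremal rest (adjacent⇒linked _ adjacent⇒edge) receding (⊇C v∈C)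

  xmax≡head : xmax k C ≡ w₀ ⊔ w₁
  xmax≡head = xmax≡ (endpoint∈C (⊔-sel w₀ w₁)) (proj₁ (sides head-edge∈)) (proj₁ ∘ bounds)

  ymin≡head : ymin k C ≡ w₀ ⊓ w₁
  ymin≡head = ymin≡ (endpoint∈C (⊓-sel w₀ w₁)) (proj₂ (sides head-edge∈)) (proj₂ ∘ bounds)

module _ {n k : ℕ} (k≤n : k ≤ n) {S T : Subset n} (∣S∣≡k : ∣ S ∣ ≡ k) (∣T∣≡k : ∣ T ∣ ≡ k)
         {C : List ℕ} (o : Orientation k S T C) where

  open Orientation o

  private
    module ST = HeadEdge k≤n {S} {T} ∣S∣≡k path receding
    module TS = HeadEdge k≤n {T} {S} ∣T∣≡k (componentPath-swap path) receding

  head-edge-good : Good k S T (w₀ ⊔ w₁) (w₀ ⊓ w₁)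
  head-edge-good with ∈-++⁻ (f k S) (head-edge∈ o)
  ... | inj₁ s = inj₂ (Rules.a≡v1 k S s , TS.a≡v0-at-head refl s)
  ... | inj₂ t = inj₁ (ST.a≡v0-at-head refl t , Rules.a≡v1 k T t)

  good⇒head-edge : Good k S T x y → x ∈ C → (x , y) ≡ edge w₀ w₁
  good⇒head-edge (inj₁ (aS≡v0 , aT≡v1)) = ST.a≡v0⇒head (Rules.a≡v1⇒ k T aT≡v1) aS≡v0 ∘ ⊇C
  good⇒head-edge (inj₂ (aS≡v1 , aT≡v0)) = TS.a≡v0⇒head (Rules.a≡v1⇒ k S aS≡v1) aT≡v0 ∘ ⊇C

mainTheorem10 : (n k : ℕ) → 1 ≤ k → k ≤ n →
    (S T : Subset n) → ∣ S ∣ ≡ k → ∣ T ∣ ≡ k → S ≢ T →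
    (C : List ℕ) → PathComponent (hEdges k S T) C →
    ((xmax k C , ymin k C) ∈ hEdges k S T)
    × Good k S T (xmax k C) (ymin k C)
    × ((x y : ℕ) → (x , y) ∈ hEdges k S T → x ∈ C → Good k S T x y →
         (x ≡ xmax k C) × (y ≡ ymin k C))
mainTheorem10 n k _ k≤n S T ∣S∣≡k ∣T∣≡k _ C pc
  with o ← orientation {k = k} {S} {T} (pathComponent⇒componentPath pc) (PathComponent.nontriv pc)
  rewrite xmax≡head o | ymin≡head o =
  head-edge∈ o , head-edge-good k≤n ∣S∣≡k ∣T∣≡k o ,
  λ _ _ _ x∈C good → ,-injective (good⇒head-edge k≤n ∣S∣≡k ∣T∣≡k o good x∈C)
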